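{- Let $F$ be a finite field with $q$ elements and let $V$ be a vector space over $F$ of finite dimension $n\ge 1$. Then the chromatic number of the linear dependence graph $\Gamma(V)$ is $q$.
   Context: For a finite-dimensional vector space $V$ over a finite field $F$, the linear dependence graph $\Gamma(V)$ is the simple graph whose vertex set is $V$, two vertices $a,b$ being adjacent if and only if $a\neq b$ and $\{a,b\}$ is linearly dependent. -}

module Defs where

open import Level using (Level; _⊔_)
open import Data.Nat using (ℕ; zero; suc; _<_)
open import Data.Fin using (Fin; zero; suc)
open import Data.Product using (Σ; ∃; ∃-syntax; _×_; _,_)
open import Data.Sum using (_⊎_)
open import Function using (_∘_)
open import Relation.Nullary using (¬_)
open import Relation.Binary.PropositionalEquality using (_≡_; _≢_)
open import Algebra.Bundles using (CommutativeRing)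
open import Algebra.Module.Bundles using (Module)

private variable c ℓ m ℓm a ℓa : Level

IsField : CommutativeRing c ℓ → Set (c ⊔ ℓ)
IsField F = ¬ (1# ≈ 0#) × (∀ x → ¬ (x ≈ 0#) → ∃[ y ] (x * y ≈ 1#))
  where open CommutativeRing F

HasCardinality : {A : Set a} → (A → A → Set ℓa) → ℕ → Set (a ⊔ ℓa)
HasCardinality {A = A} _≈_ q =
  Σ (Fin q → A) λ e → (∀ i j → e i ≈ e j → i ≡ j) × (∀ x → ∃[ i ] (e i ≈ x))

module _ {F : CommutativeRing c ℓ} (V : Module F m ℓm) where
  open CommutativeRing F using (Carrier; _≈_; 0#)
  open Module V using (Carrierᴹ; _≈ᴹ_; _+ᴹ_; _*ₗ_; 0ᴹ)

  lincomb : ∀ {n} → (Fin n → Carrier) → (Fin n → Carrierᴹ) → Carrierᴹ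
  lincomb {zero}  a v = 0ᴹ
  lincomb {suc n} a v = (a zero *ₗ v zero) +ᴹ lincomb (a ∘ suc) (v ∘ suc)

  LinearlyIndependent : ∀ {n} → (Fin n → Carrierᴹ) → Set (c ⊔ ℓ ⊔ ℓm)
  LinearlyIndependent v = ∀ a → lincomb a v ≈ᴹ 0ᴹ → ∀ i → a i ≈ 0#

  Spans : ∀ {n} → (Fin n → Carrierᴹ) → Set (c ⊔ m ⊔ ℓm)
  Spans v = ∀ x → ∃[ a ] (lincomb a v ≈ᴹ x)

  IsBasis : ∀ {n} → (Fin n → Carrierᴹ) → Set (c ⊔ ℓ ⊔ m ⊔ ℓm)
  IsBasis v = LinearlyIndependent v × Spans v

  HasDimension : ℕ → Set (c ⊔ ℓ ⊔ m ⊔ ℓm)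
  HasDimension n = Σ (Fin n → Carrierᴹ) IsBasis

  LinDep₂ : Carrierᴹ → Carrierᴹ → Set (c ⊔ ℓ ⊔ ℓm)
  LinDep₂ u w = ∃[ λ₁ ] ∃[ λ₂ ] ((¬ (λ₁ ≈ 0#) ⊎ ¬ (λ₂ ≈ 0#)) × ((λ₁ *ₗ u) +ᴹ (λ₂ *ₗ w) ≈ᴹ 0ᴹ))

  Γ-Adj : Carrierᴹ → Carrierᴹ → Set (c ⊔ ℓ ⊔ ℓm)
  Γ-Adj u w = ¬ (u ≈ᴹ w) × LinDep₂ u w

module _ {A : Set a} (_≈_ : A → A → Set ℓa) {ℓr : Level} (Adj : A → A → Set ℓr) where

  ProperColouring : (k : ℕ) → (A → Fin k) → Set (a ⊔ ℓa ⊔ ℓr)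
  ProperColouring k col =
    (∀ x y → x ≈ y → col x ≡ col y) × (∀ x y → Adj x y → col x ≢ col y)

  Colourable : ℕ → Set (a ⊔ ℓa ⊔ ℓr)
  Colourable k = ∃[ col ] ProperColouring k col

  ChromaticNumber : ℕ → Set (a ⊔ ℓa ⊔ ℓr)
  ChromaticNumber χ = Colourable χ × (∀ k → k < χ → ¬ Colourable k)

-- Colour a vector by its leading coordinate, i.e. its first nonzero coordinate in a fixed
-- basis (or 0 for the zero vector). Adjacent vertices are distinct multiples y = μ x, and
-- the leading coordinate of μ x is μ times that of x, so equal colours force μ = 1 or
-- x = 0, hence x = y. This gives q colours; conversely the q multiples a·e₀ of a basis
-- vector are pairwise adjacent, so fewer colours are impossible.
module Submission where

open import Level using (Level)
open import Data.Nat using (ℕ; zero; suc; _≤_; _<_)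
open import Data.Fin using (Fin; zero; suc)
open import Data.Fin.Properties using (pigeonhole; <⇒≢) renaming (_≟_ to _≟ᶠ_)
open import Data.Product using (∃-syntax; _,_; proj₁; proj₂)
open import Data.Sum using (_⊎_; inj₁; inj₂)
open import Function using (_∘_)
open import Relation.Nullary using (¬_; Dec; yes; no; contradiction)
open import Relation.Nullary.Decidable using (map′)
open import Relation.Binary using (Setoid)
open import Relation.Binary.PropositionalEquality using (_≡_; _≢_; cong)
open import Algebra.Bundles using (CommutativeRing; CommutativeMonoid)
open import Algebra.Module.Bundles using (Module)
import Algebra.Properties.Ring as RingProperties
import Algebra.Properties.CommutativeSemigroup as CommutativeSemigroupProperties
import Algebra.Module.Properties as ModuleProperties
import Relation.Binary.Reasoning.Setoid as SetoidReasoning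

open import Defs

private variable a ℓa ℓr c ℓ m ℓm : Level

clique⇒¬Colourable : ∀ {A : Set a} {_≈_ : A → A → Set ℓa} {Adj : A → A → Set ℓr} {q : ℕ}
  (v : Fin q → A) → (∀ i j → i ≢ j → Adj (v i) (v j)) → ∀ k → k < q → ¬ Colourable _≈_ Adj k
clique⇒¬Colourable v clique k k<q (col , _ , proper) with pigeonhole k<q (col ∘ v)
... | i , j , i<j , same = proper (v i) (v j) (clique i j (<⇒≢ i<j)) same

module Enumeration (S : Setoid a ℓa) {q : ℕ} (card : HasCardinality (Setoid._≈_ S) q) where
  open Setoid S

  enumerate : Fin q → Carrier
  enumerate = proj₁ card

  enumerate-injective : ∀ i j → enumerate i ≈ enumerate j → i ≡ j
  enumerate-injective = proj₁ (proj₂ card)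

  index : Carrier → Fin q
  index x = proj₁ (proj₂ (proj₂ card) x)

  enumerate-index : ∀ x → enumerate (index x) ≈ x
  enumerate-index x = proj₂ (proj₂ (proj₂ card) x)

  index-cong : ∀ {x y} → x ≈ y → index x ≡ index y
  index-cong {x} {y} x≈y =
    enumerate-injective _ _ (trans (enumerate-index x) (trans x≈y (sym (enumerate-index y))))

  index-injective : ∀ {x y} → index x ≡ index y → x ≈ y
  index-injective {x} {y} same =
    trans (sym (enumerate-index x)) (trans (reflexive (cong enumerate same)) (enumerate-index y))

  _≟_ : ∀ x y → Dec (x ≈ y)
  x ≟ y = map′ index-injective index-cong (index x ≟ᶠ index y)

module FieldProperties (F : CommutativeRing c ℓ) (isField : IsField F) where
  open CommutativeRing F hiding (zero)
  open SetoidReasoning setoid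

  *-cancelʳ-nonzero : ∀ {x y z} → x ≉ 0# → y * x ≈ z * x → y ≈ z
  *-cancelʳ-nonzero {x} {y} {z} x≉0 yx≈zx with proj₂ isField x x≉0
  ... | ι , xι≈1 = begin
    y            ≈⟨ sym (*-identityʳ y) ⟩
    y * 1#       ≈⟨ *-congˡ (sym xι≈1) ⟩
    y * (x * ι)  ≈⟨ sym (*-assoc y x ι) ⟩
    (y * x) * ι  ≈⟨ *-congʳ yx≈zx ⟩
    (z * x) * ι  ≈⟨ *-assoc z x ι ⟩
    z * (x * ι)  ≈⟨ *-congˡ xι≈1 ⟩
    z * 1#       ≈⟨ *-identityʳ z ⟩
    z            ∎

  module LeadingCoefficient (isZero? : ∀ x → Dec (x ≈ 0#)) where

    lead : ∀ {n} → (Fin n → Carrier) → Carrier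
    lead {zero}  a = 0#
    lead {suc n} a with isZero? (a zero)
    ... | yes _ = lead (a ∘ suc)
    ... | no _  = a zero

    lead-cong : ∀ {n} {a b : Fin n → Carrier} → (∀ i → a i ≈ b i) → lead a ≈ lead b
    lead-cong {zero} _ = refl
    lead-cong {suc n} {a} {b} a≈b with isZero? (a zero) | isZero? (b zero)
    ... | yes _     | yes _     = lead-cong (a≈b ∘ suc)
    ... | yes a₀≈0  | no b₀≉0   = contradiction (trans (sym (a≈b zero)) a₀≈0) b₀≉0
    ... | no a₀≉0   | yes b₀≈0  = contradiction (trans (a≈b zero) b₀≈0) a₀≉0
    ... | no _      | no _      = a≈b zero

    lead≈0⇒≈0 : ∀ {n} (a : Fin n → Carrier) → lead a ≈ 0# → ∀ i → a i ≈ 0#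
    lead≈0⇒≈0 {suc n} a lead≈0 i with isZero? (a zero) | i
    ... | yes a₀≈0 | zero  = a₀≈0
    ... | yes _    | suc i = lead≈0⇒≈0 (a ∘ suc) lead≈0 i
    ... | no _     | zero  = lead≈0
    ... | no a₀≉0  | suc _ = contradiction lead≈0 a₀≉0

    lead-* : ∀ {n} μ (a : Fin n → Carrier) → lead (λ i → μ * a i) ≈ μ * lead a
    lead-* {zero} μ a = sym (zeroʳ μ)
    lead-* {suc n} μ a with isZero? (μ * a zero) | isZero? (a zero)
    ... | yes _      | yes _     = lead-* μ (a ∘ suc)
    ... | no μa₀≉0   | yes a₀≈0  = contradiction (trans (*-congˡ a₀≈0) (zeroʳ μ)) μa₀≉0
    ... | no _       | no _      = refl
    ... | yes μa₀≈0  | no a₀≉0   = begin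
      lead (λ i → μ * a (suc i))  ≈⟨ lead-* μ (a ∘ suc) ⟩
      μ * lead (a ∘ suc)          ≈⟨ *-congʳ μ≈0 ⟩
      0# * lead (a ∘ suc)         ≈⟨ zeroˡ _ ⟩
      0#                          ≈⟨ sym μa₀≈0 ⟩
      μ * a zero                  ∎
      where
      μ≈0 : μ ≈ 0#
      μ≈0 = *-cancelʳ-nonzero a₀≉0 (trans μa₀≈0 (sym (zeroˡ (a zero))))

module VectorSpace {F : CommutativeRing c ℓ} (V : Module F m ℓm) where
  open CommutativeRing F hiding (zero)
  open Module V
  open RingProperties ring using (-‿involutive; -0#≈0#; x∙y⁻¹≈ε⇒x≈y)
  open ModuleProperties V using (inverseʳ-uniqueᴹ)
  open CommutativeSemigroupProperties (CommutativeMonoid.commutativeSemigroup +ᴹ-commutativeMonoid)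
    using (interchange)
  open SetoidReasoning ≈ᴹ-setoid

  -‿*ₗ : ∀ a u → (- a) *ₗ u ≈ᴹ -ᴹ (a *ₗ u)
  -‿*ₗ a u = inverseʳ-uniqueᴹ (a *ₗ u) ((- a) *ₗ u) (begin
    a *ₗ u +ᴹ (- a) *ₗ u  ≈⟨ ≈ᴹ-sym (*ₗ-distribʳ u a (- a)) ⟩
    (a + - a) *ₗ u        ≈⟨ *ₗ-congʳ (-‿inverseʳ a) ⟩
    0# *ₗ u               ≈⟨ *ₗ-zeroˡ u ⟩
    0ᴹ                    ∎)

  lincomb-cong : ∀ {n} {a b : Fin n → Carrier} (v : Fin n → Carrierᴹ) → (∀ i → a i ≈ b i)
               → lincomb V a v ≈ᴹ lincomb V b v
  lincomb-cong {zero}  v a≈b = ≈ᴹ-refl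
  lincomb-cong {suc n} v a≈b = +ᴹ-cong (*ₗ-congʳ (a≈b zero)) (lincomb-cong (v ∘ suc) (a≈b ∘ suc))

  lincomb-0 : ∀ {n} (v : Fin n → Carrierᴹ) → lincomb V (λ _ → 0#) v ≈ᴹ 0ᴹ
  lincomb-0 {zero}  v = ≈ᴹ-refl
  lincomb-0 {suc n} v = begin
    0# *ₗ v zero +ᴹ lincomb V (λ _ → 0#) (v ∘ suc)  ≈⟨ +ᴹ-cong (*ₗ-zeroˡ (v zero)) (lincomb-0 (v ∘ suc)) ⟩
    0ᴹ +ᴹ 0ᴹ                                         ≈⟨ +ᴹ-identityˡ 0ᴹ ⟩
    0ᴹ                                               ∎

  lincomb-+ : ∀ {n} (a b : Fin n → Carrier) (v : Fin n → Carrierᴹ)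
            → lincomb V (λ i → a i + b i) v ≈ᴹ lincomb V a v +ᴹ lincomb V b v
  lincomb-+ {zero}  a b v = ≈ᴹ-sym (+ᴹ-identityˡ 0ᴹ)
  lincomb-+ {suc n} a b v = begin
    (a zero + b zero) *ₗ v zero +ᴹ lincomb V (λ i → a (suc i) + b (suc i)) (v ∘ suc)
      ≈⟨ +ᴹ-cong (*ₗ-distribʳ (v zero) (a zero) (b zero)) (lincomb-+ (a ∘ suc) (b ∘ suc) (v ∘ suc)) ⟩
    (a zero *ₗ v zero +ᴹ b zero *ₗ v zero) +ᴹ (lincomb V (a ∘ suc) (v ∘ suc) +ᴹ lincomb V (b ∘ suc) (v ∘ suc))
      ≈⟨ interchange _ _ _ _ ⟩
    lincomb V a v +ᴹ lincomb V b v ∎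

  lincomb-* : ∀ {n} μ (a : Fin n → Carrier) (v : Fin n → Carrierᴹ)
            → lincomb V (λ i → μ * a i) v ≈ᴹ μ *ₗ lincomb V a v
  lincomb-* {zero}  μ a v = ≈ᴹ-sym (*ₗ-zeroʳ μ)
  lincomb-* {suc n} μ a v = begin
    (μ * a zero) *ₗ v zero +ᴹ lincomb V (λ i → μ * a (suc i)) (v ∘ suc)
      ≈⟨ +ᴹ-cong (*ₗ-assoc μ (a zero) (v zero)) (lincomb-* μ (a ∘ suc) (v ∘ suc)) ⟩
    μ *ₗ (a zero *ₗ v zero) +ᴹ μ *ₗ lincomb V (a ∘ suc) (v ∘ suc)
      ≈⟨ ≈ᴹ-sym (*ₗ-distribˡ μ _ _) ⟩
    μ *ₗ lincomb V a v ∎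

  lincomb-- : ∀ {n} (a : Fin n → Carrier) (v : Fin n → Carrierᴹ)
            → lincomb V (-_ ∘ a) v ≈ᴹ -ᴹ lincomb V a v
  lincomb-- a v = inverseʳ-uniqueᴹ (lincomb V a v) (lincomb V (-_ ∘ a) v) (begin
    lincomb V a v +ᴹ lincomb V (-_ ∘ a) v  ≈⟨ ≈ᴹ-sym (lincomb-+ a (-_ ∘ a) v) ⟩
    lincomb V (λ i → a i + - a i) v        ≈⟨ lincomb-cong v (-‿inverseʳ ∘ a) ⟩
    lincomb V (λ _ → 0#) v                 ≈⟨ lincomb-0 v ⟩
    0ᴹ                                     ∎)

  lincomb-injective : ∀ {n} {v : Fin n → Carrierᴹ} → LinearlyIndependent V v
    → ∀ {a b} → lincomb V a v ≈ᴹ lincomb V b v → ∀ i → a i ≈ b i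
  lincomb-injective {v = v} independent {a} {b} same i =
    x∙y⁻¹≈ε⇒x≈y (a i) (b i) (independent (λ j → a j + - b j) difference≈0 i)
    where
    difference≈0 : lincomb V (λ j → a j + - b j) v ≈ᴹ 0ᴹ
    difference≈0 = begin
      lincomb V (λ j → a j + - b j) v         ≈⟨ lincomb-+ a (-_ ∘ b) v ⟩
      lincomb V a v +ᴹ lincomb V (-_ ∘ b) v   ≈⟨ +ᴹ-cong same (lincomb-- b v) ⟩
      lincomb V b v +ᴹ -ᴹ lincomb V b v       ≈⟨ -ᴹ‿inverseʳ (lincomb V b v) ⟩
      0ᴹ                                      ∎

  single₀ : ∀ {n} → Carrier → Fin (suc n) → Carrier
  single₀ x zero    = x
  single₀ x (suc _) = 0#

  lincomb-single₀ : ∀ {n} x (v : Fin (suc n) → Carrierᴹ) → lincomb V (single₀ x) v ≈ᴹ x *ₗ v zero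
  lincomb-single₀ x v = ≈ᴹ-trans (+ᴹ-congˡ (lincomb-0 (v ∘ suc))) (+ᴹ-identityʳ (x *ₗ v zero))

  *ₗ-cancelʳ-independent₀ : ∀ {n} {v : Fin (suc n) → Carrierᴹ} → LinearlyIndependent V v
    → ∀ {x y} → x *ₗ v zero ≈ᴹ y *ₗ v zero → x ≈ y
  *ₗ-cancelʳ-independent₀ {v = v} independent {x} {y} same =
    lincomb-injective {v = v} independent {single₀ x} {single₀ y}
      (≈ᴹ-trans (lincomb-single₀ x v) (≈ᴹ-trans same (≈ᴹ-sym (lincomb-single₀ y v)))) zero

  module Coordinates {n} {basis : Fin n → Carrierᴹ} (isBasis : IsBasis V basis) where

    coordinates : Carrierᴹ → Fin n → Carrier
    coordinates x = proj₁ (proj₂ isBasis x)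

    lincomb-coordinates : ∀ x → lincomb V (coordinates x) basis ≈ᴹ x
    lincomb-coordinates x = proj₂ (proj₂ isBasis x)

    coordinates-cong : ∀ {x y} → x ≈ᴹ y → ∀ i → coordinates x i ≈ coordinates y i
    coordinates-cong {x} {y} x≈y = lincomb-injective (proj₁ isBasis)
      (≈ᴹ-trans (lincomb-coordinates x) (≈ᴹ-trans x≈y (≈ᴹ-sym (lincomb-coordinates y))))

    coordinates-injective : ∀ {x y} → (∀ i → coordinates x i ≈ coordinates y i) → x ≈ᴹ y
    coordinates-injective {x} {y} same = begin
      x                                ≈⟨ ≈ᴹ-sym (lincomb-coordinates x) ⟩
      lincomb V (coordinates x) basis  ≈⟨ lincomb-cong basis same ⟩
      lincomb V (coordinates y) basis  ≈⟨ lincomb-coordinates y ⟩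
      y                                ∎

    coordinates≈0⇒≈0 : ∀ {x} → (∀ i → coordinates x i ≈ 0#) → x ≈ᴹ 0ᴹ
    coordinates≈0⇒≈0 {x} x≈0 = begin
      x                                ≈⟨ ≈ᴹ-sym (lincomb-coordinates x) ⟩
      lincomb V (coordinates x) basis  ≈⟨ lincomb-cong basis x≈0 ⟩
      lincomb V (λ _ → 0#) basis       ≈⟨ lincomb-0 basis ⟩
      0ᴹ                               ∎

    coordinates-*ₗ : ∀ μ x i → coordinates (μ *ₗ x) i ≈ μ * coordinates x i
    coordinates-*ₗ μ x = lincomb-injective (proj₁ isBasis) (begin
      lincomb V (coordinates (μ *ₗ x)) basis       ≈⟨ lincomb-coordinates (μ *ₗ x) ⟩
      μ *ₗ x                                       ≈⟨ *ₗ-congˡ (≈ᴹ-sym (lincomb-coordinates x)) ⟩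
      μ *ₗ lincomb V (coordinates x) basis         ≈⟨ ≈ᴹ-sym (lincomb-* μ (coordinates x) basis) ⟩
      lincomb V (λ i → μ * coordinates x i) basis  ∎)

  multiples-dependent : (∀ x → Dec (x ≈ 0#)) → ∀ {a b} → a ≉ b → ∀ v → LinDep₂ V (a *ₗ v) (b *ₗ v)
  multiples-dependent isZero? {a} {b} a≉b v = b , - a , nonzero , (begin
    b *ₗ (a *ₗ v) +ᴹ (- a) *ₗ (b *ₗ v)      ≈⟨ +ᴹ-congˡ (-‿*ₗ a (b *ₗ v)) ⟩
    b *ₗ (a *ₗ v) +ᴹ -ᴹ (a *ₗ (b *ₗ v))      ≈⟨ +ᴹ-congˡ (-ᴹ‿cong commute) ⟩
    b *ₗ (a *ₗ v) +ᴹ -ᴹ (b *ₗ (a *ₗ v))      ≈⟨ -ᴹ‿inverseʳ (b *ₗ (a *ₗ v)) ⟩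
    0ᴹ                                       ∎)
    where
    nonzero : b ≉ 0# ⊎ - a ≉ 0#
    nonzero with isZero? b
    ... | no b≉0  = inj₁ b≉0
    ... | yes b≈0 = inj₂ λ -a≈0 →
      a≉b (trans (sym (-‿involutive a)) (trans (-‿cong -a≈0) (trans -0#≈0# (sym b≈0))))

    commute : a *ₗ (b *ₗ v) ≈ᴹ b *ₗ (a *ₗ v)
    commute = begin
      a *ₗ (b *ₗ v)  ≈⟨ ≈ᴹ-sym (*ₗ-assoc a b v) ⟩
      (a * b) *ₗ v   ≈⟨ *ₗ-congʳ (*-comm a b) ⟩
      (b * a) *ₗ v   ≈⟨ *ₗ-assoc b a v ⟩
      b *ₗ (a *ₗ v)  ∎

  module _ (isField : IsField F) where

    solution⇒multiple : ∀ {λ₁ λ₂ u w} → λ₂ ≉ 0# → λ₁ *ₗ u +ᴹ λ₂ *ₗ w ≈ᴹ 0ᴹ → ∃[ μ ] w ≈ᴹ μ *ₗ u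
    solution⇒multiple {λ₁} {λ₂} {u} {w} λ₂≉0 solution with proj₂ isField λ₂ λ₂≉0
    ... | ι , λ₂ι≈1 = - (ι * λ₁) , (begin
      w                   ≈⟨ inverseʳ-uniqueᴹ _ _ scaled-solution ⟩
      -ᴹ ((ι * λ₁) *ₗ u)  ≈⟨ ≈ᴹ-sym (-‿*ₗ (ι * λ₁) u) ⟩
      (- (ι * λ₁)) *ₗ u   ∎)
      where
      scaled-solution : (ι * λ₁) *ₗ u +ᴹ w ≈ᴹ 0ᴹ
      scaled-solution = begin
        (ι * λ₁) *ₗ u +ᴹ w
          ≈⟨ +ᴹ-congˡ (≈ᴹ-sym (≈ᴹ-trans (*ₗ-congʳ (trans (*-comm ι λ₂) λ₂ι≈1)) (*ₗ-identityˡ w))) ⟩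
        (ι * λ₁) *ₗ u +ᴹ (ι * λ₂) *ₗ w    ≈⟨ +ᴹ-cong (*ₗ-assoc ι λ₁ u) (*ₗ-assoc ι λ₂ w) ⟩
        ι *ₗ (λ₁ *ₗ u) +ᴹ ι *ₗ (λ₂ *ₗ w)  ≈⟨ ≈ᴹ-sym (*ₗ-distribˡ ι _ _) ⟩
        ι *ₗ (λ₁ *ₗ u +ᴹ λ₂ *ₗ w)         ≈⟨ *ₗ-congˡ solution ⟩
        ι *ₗ 0ᴹ                           ≈⟨ *ₗ-zeroʳ ι ⟩
        0ᴹ                                ∎

    dependent⇒multiple : ∀ {u w} → LinDep₂ V u w → (∃[ μ ] w ≈ᴹ μ *ₗ u) ⊎ (∃[ μ ] u ≈ᴹ μ *ₗ w)
    dependent⇒multiple (_ , _ , inj₂ λ₂≉0 , solution) = inj₁ (solution⇒multiple λ₂≉0 solution)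
    dependent⇒multiple (_ , _ , inj₁ λ₁≉0 , solution) =
      inj₂ (solution⇒multiple λ₁≉0 (≈ᴹ-trans (+ᴹ-comm _ _) solution))

module FiniteVectorSpace {F : CommutativeRing c ℓ} (isField : IsField F)
  {q : ℕ} (card : HasCardinality (CommutativeRing._≈_ F) q) (V : Module F m ℓm) where
  open CommutativeRing F hiding (zero)
  open Module V
  open Enumeration setoid card
  open FieldProperties F isField
  open LeadingCoefficient (_≟ 0#)
  open VectorSpace V

  module _ {n} {basis : Fin n → Carrierᴹ} (isBasis : IsBasis V basis) where
    open Coordinates isBasis

    colour : Carrierᴹ → Fin q
    colour x = index (lead (coordinates x))

    multiple-with-same-lead : ∀ {x y} μ → y ≈ᴹ μ *ₗ x
      → lead (coordinates x) ≈ lead (coordinates y) → x ≈ᴹ y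
    multiple-with-same-lead {x} {y} μ y≈μx same with lead (coordinates x) ≟ 0#
    ... | yes lead≈0 = ≈ᴹ-trans x≈0 (≈ᴹ-sym (≈ᴹ-trans y≈μx (≈ᴹ-trans (*ₗ-congˡ x≈0) (*ₗ-zeroʳ μ))))
      where
      x≈0 : x ≈ᴹ 0ᴹ
      x≈0 = coordinates≈0⇒≈0 (lead≈0⇒≈0 (coordinates x) lead≈0)
    ... | no lead≉0 = ≈ᴹ-sym (≈ᴹ-trans y≈μx (≈ᴹ-trans (*ₗ-congʳ μ≈1) (*ₗ-identityˡ x)))
      where
      lead-scales : lead (coordinates y) ≈ μ * lead (coordinates x)
      lead-scales = trans (lead-cong λ i → trans (coordinates-cong y≈μx i) (coordinates-*ₗ μ x i))
                          (lead-* μ (coordinates x))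
      μ≈1 : μ ≈ 1#
      μ≈1 = *-cancelʳ-nonzero lead≉0
              (trans (sym (trans same lead-scales)) (sym (*-identityˡ _)))

    colour-proper : ProperColouring _≈ᴹ_ (Γ-Adj V) q colour
    colour-proper = (λ _ _ → index-cong ∘ lead-cong ∘ coordinates-cong) , adjacent⇒different
      where
      adjacent⇒different : ∀ x y → Γ-Adj V x y → colour x ≢ colour y
      adjacent⇒different x y (x≉y , dependent) same with dependent⇒multiple isField dependent
      ... | inj₁ (μ , y≈μx) = x≉y (multiple-with-same-lead μ y≈μx (index-injective same))
      ... | inj₂ (μ , x≈μy) = x≉y (≈ᴹ-sym (multiple-with-same-lead μ x≈μy (sym (index-injective same))))

  scalar-multiples-clique : ∀ {n} {basis : Fin (suc n) → Carrierᴹ} → IsBasis V basis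
    → ∀ i j → i ≢ j → Γ-Adj V (enumerate i *ₗ basis zero) (enumerate j *ₗ basis zero)
  scalar-multiples-clique {basis = basis} (independent , _) i j i≢j =
    i≢j ∘ enumerate-injective i j ∘ *ₗ-cancelʳ-independent₀ {v = basis} independent ,
    multiples-dependent (_≟ 0#) (i≢j ∘ enumerate-injective i j) (basis zero)

mainTheorem7 : ∀ {c ℓ m ℓm} (F : CommutativeRing c ℓ) → IsField F
    → (q : ℕ) → HasCardinality (CommutativeRing._≈_ F) q
    → (V : Module F m ℓm) → (n : ℕ) → 1 ≤ n → HasDimension V n
    → ChromaticNumber (Module._≈ᴹ_ V) (Γ-Adj V) q
mainTheorem7 F isField q card V (suc n) _ (basis , isBasis) =
  (colour {basis = basis} isBasis , colour-proper {basis = basis} isBasis) ,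
  clique⇒¬Colourable (λ i → enumerate i *ₗ basis zero) (scalar-multiples-clique {basis = basis} isBasis)
  where
  open FiniteVectorSpace isField card V
  open Enumeration (CommutativeRing.setoid F) card using (enumerate)
  open Module V using (_*ₗ_)
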